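{- Let $n \ge k \ge 3$ be integers. Then $(P_n,k)$ is niche-realizable if and only if $(n,k)\in\{(3,3),(4,3),(4,4),(5,3)\}$.
   Context: $P_n$ is the path on $n$ vertices. A $k$-partite tournament is an orientation of a complete $k$-partite graph with $k$ nonempty partite sets. The niche graph $\mathcal{N}(D)$ of a digraph $D$ has vertex set $V(D)$, and two distinct vertices are adjacent iff they have a common out-neighbor in $D$ or a common in-neighbor in $D$. The pair $(G,k)$ is niche-realizable if $G$ is isomorphic to the niche graph of some $k$-partite tournament. -}

module Defs where

open import Level using (0ℓ)
open import Data.Nat using (ℕ; suc)
open import Data.Fin using (Fin; toℕ)
open import Data.Product using (Σ; ∃; _×_; _,_)
open import Data.Sum using (_⊎_)
open import Relation.Nullary using (¬_)
open import Relation.Binary.PropositionalEquality using (_≡_; _≢_)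
open import Function.Bundles using (_⤖_; Bijection; _⇔_)

Graph : ℕ → Set₁
Graph n = Fin n → Fin n → Set

Digraph : ℕ → Set₁
Digraph m = Fin m → Fin m → Set

Path : (n : ℕ) → Graph n
Path n i j = (toℕ j ≡ suc (toℕ i)) ⊎ (toℕ i ≡ suc (toℕ j))

record IsKPartiteTournament {m : ℕ} (k : ℕ) (D : Digraph m) (part : Fin m → Fin k) : Set where
  field
    nonempty   : (p : Fin k) → ∃ λ v → part v ≡ p
    noArcInside : ∀ u v → part u ≡ part v → ¬ D u v
    someArc    : ∀ u v → part u ≢ part v → D u v ⊎ D v u
    notBoth    : ∀ u v → ¬ (D u v × D v u)

KPartiteTournament : {m : ℕ} → ℕ → Digraph m → Set
KPartiteTournament {m} k D = Σ (Fin m → Fin k) λ part → IsKPartiteTournament k D part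

Niche : {m : ℕ} → Digraph m → Graph m
Niche D u v = (u ≢ v) × ((∃ λ w → D u w × D v w) ⊎ (∃ λ w → D w u × D w v))

_≅_ : {n m : ℕ} → Graph n → Graph m → Set
_≅_ {n} {m} G H = Σ (Fin n ⤖ Fin m) λ f →
  ∀ i j → G i j ⇔ H (Bijection.to f i) (Bijection.to f j)

NicheRealizable : {n : ℕ} → Graph n → ℕ → Set₁
NicheRealizable G k = Σ ℕ λ m → Σ (Digraph m) λ D → KPartiteTournament k D × (G ≅ Niche D)

-- Since P_n is triangle-free, no vertex has three out-neighbours or three in-neighbours, so at most
-- four vertices lie outside the part of any vertex. Let x be an end of the path and y its neighbour:
-- a vertex sharing an out- or in-neighbour with x must be y, so the out-neighbours of x other than y
-- lie in a single part, and so do its in-neighbours. For k ≥ 4 this forces {y} to be a whole part;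
-- then all vertices other than x and y are out-neighbours of y (or all are in-neighbours), hence
-- pairwise niche-adjacent, which fails once n ≥ 5. For k = 3 and n ≥ 6, counting forces every part
-- to have exactly two vertices and every vertex in- and out-degree two; so {x, y} is a part, and a
-- second out-neighbour of x beside the other neighbour z of y yields a niche triangle or a second
-- niche neighbour of x. Reversing all arcs preserves the niche graph and halves every case analysis.
-- The four exceptional pairs are realized by explicit tournaments checked by computation.

module Submission where

open import Defs
open import Level using (Level)
open import Data.Nat using (ℕ; zero; suc; _+_; _≤_; _<_; z≤n; s≤s)
import Data.Nat.Properties as ℕ
open import Data.Nat.Properties
  using ( ≤-refl; n≤1+n; ≤-trans; ≤-reflexive; ≤-antisym; ≤-pred; <⇒≢; 1+n≰n; 1+n≢n; m≢1+n+m
        ; +-suc; +-comm; +-identityʳ; m≤m+n; +-mono-≤; +-monoˡ-≤; +-monoʳ-≤; +-cancelʳ-≤; +-cancelˡ-≤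
        ; m≤n⇒∃[o]m+o≡n; module ≤-Reasoning )
open import Data.Fin using (Fin; zero; suc; toℕ; punchIn; inject≤)
open import Data.Fin.Patterns using (0F; 1F; 2F; 4F)
open import Data.Fin.Properties
  using (_≟_; any?; all?; suc-injective; injective⇒≤; punchIn-injective; punchInᵢ≢i; inject≤-injective)
open import Data.Product using (∃; _×_; _,_; proj₁; proj₂)
open import Data.Product.Properties using (≡-dec)
open import Data.List using (List; []; _∷_)
open import Data.List.Membership.DecPropositional (≡-dec ℕ._≟_ ℕ._≟_) using (_∈_; _∈?_)
open import Data.Vec using (lookup; []; _∷_)
open import Data.Sum using (_⊎_; inj₁; inj₂; swap)
open import Data.Empty using (⊥; ⊥-elim)
open import Function using (_∘_; flip; id)
open import Function.Definitions using (Injective)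
open import Function.Bundles using (Bijection; Equivalence; _⇔_; mk⇔)
open import Function.Construct.Identity using (⤖-id)
open import Data.Bool using (if_then_else_)
open import Relation.Nullary using (¬_; Dec; yes; no; does; contradiction; ¬?)
open import Relation.Nullary.Decidable using (True; toWitness; map′; _×-dec_; _⊎-dec_; _→-dec_)
open import Relation.Unary using (Pred; Decidable; _⊆_; _∪_; _∩_; ∁; _∖_; ｛_｝; Empty; Satisfiable; _≐_)
open import Relation.Unary.Properties using (_∪?_; _∩?_; ∁?)
open import Relation.Binary.Definitions using () renaming (Decidable to Decidable₂)
open import Relation.Binary.PropositionalEquality
  using (_≡_; _≢_; refl; sym; trans; cong; subst; module ≡-Reasoning)

private
  variable
    p q : Level
    m k : ℕ
    D : Digraph m
    part : Fin m → Fin k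

count : {P : Pred (Fin m) p} → Decidable P → ℕ
count {m = zero}  P? = 0
count {m = suc m} P? = (if does (P? zero) then 1 else 0) + count (P? ∘ suc)

count-mono : {P : Pred (Fin m) p} {Q : Pred (Fin m) q} (P? : Decidable P) (Q? : Decidable Q) →
             P ⊆ Q → count P? ≤ count Q?
count-mono {m = zero}  P? Q? P⊆Q = z≤n
count-mono {m = suc m} P? Q? P⊆Q with P? zero | Q? zero
... | yes _  | yes _  = s≤s (count-mono (P? ∘ suc) (Q? ∘ suc) P⊆Q)
... | yes p₀ | no ¬q₀ = contradiction (P⊆Q p₀) ¬q₀
... | no _   | yes _  = ≤-trans (count-mono (P? ∘ suc) (Q? ∘ suc) P⊆Q) (n≤1+n _)
... | no _   | no _   = count-mono (P? ∘ suc) (Q? ∘ suc) P⊆Q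

count-cong : {P : Pred (Fin m) p} {Q : Pred (Fin m) q} (P? : Decidable P) (Q? : Decidable Q) →
             P ≐ Q → count P? ≡ count Q?
count-cong P? Q? (P⊆Q , Q⊆P) = ≤-antisym (count-mono P? Q? P⊆Q) (count-mono Q? P? Q⊆P)

count-∪∩ : {P : Pred (Fin m) p} {Q : Pred (Fin m) q} (P? : Decidable P) (Q? : Decidable Q) →
           count (P? ∪? Q?) + count (P? ∩? Q?) ≡ count P? + count Q?
count-∪∩ {m = zero}  P? Q? = refl
count-∪∩ {m = suc m} P? Q? with P? zero | Q? zero | count-∪∩ (P? ∘ suc) (Q? ∘ suc)
... | yes _ | yes _ | ih = cong suc (trans (+-suc _ _) (trans (cong suc ih) (sym (+-suc _ _))))
... | yes _ | no _  | ih = cong suc ih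
... | no _  | yes _ | ih = trans (cong suc ih) (sym (+-suc _ _))
... | no _  | no _  | ih = ih

count-empty : {P : Pred (Fin m) p} (P? : Decidable P) → Empty P → count P? ≡ 0
count-empty {m = zero}  P? ∅ = refl
count-empty {m = suc m} P? ∅ with P? zero
... | yes p₀ = contradiction p₀ (∅ zero)
... | no _   = count-empty (P? ∘ suc) (∅ ∘ suc)

count-complement : {P : Pred (Fin m) p} (P? : Decidable P) → count P? + count (∁? P?) ≡ m
count-complement {m = zero}  P? = refl
count-complement {m = suc m} P? with P? zero
... | yes _ = cong suc (count-complement (P? ∘ suc))
... | no _  = trans (+-suc _ _) (cong suc (count-complement (P? ∘ suc)))

count-singleton : (a : Fin m) → count (a ≟_) ≡ 1
count-singleton {m = suc m} zero = cong suc (count-empty {m = m} (λ i → zero ≟ suc i) λ _ ())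
count-singleton (suc a)          = trans (count-cong _ (a ≟_) (suc-injective , cong suc)) (count-singleton a)

count>0⇒satisfiable : {P : Pred (Fin m) p} (P? : Decidable P) → 0 < count P? → Satisfiable P
count>0⇒satisfiable P? 0<c with any? P?
... | yes sat = sat
... | no ¬sat = contradiction (count-empty P? λ x Px → ¬sat (x , Px)) (<⇒≢ 0<c ∘ sym)

count-∪≤ : {P : Pred (Fin m) p} {Q : Pred (Fin m) q} (P? : Decidable P) (Q? : Decidable Q) →
           count (P? ∪? Q?) ≤ count P? + count Q?
count-∪≤ P? Q? = ≤-trans (m≤m+n _ _) (≤-reflexive (count-∪∩ P? Q?))

count-disjoint-∪ : {P : Pred (Fin m) p} {Q : Pred (Fin m) q} (P? : Decidable P) (Q? : Decidable Q) →
                   Empty (P ∩ Q) → count (P? ∪? Q?) ≡ count P? + count Q?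
count-disjoint-∪ P? Q? ∅ = begin
  count (P? ∪? Q?)                     ≡⟨ +-identityʳ _ ⟨
  count (P? ∪? Q?) + 0                 ≡⟨ cong (count (P? ∪? Q?) +_) (count-empty (P? ∩? Q?) ∅) ⟨
  count (P? ∪? Q?) + count (P? ∩? Q?)  ≡⟨ count-∪∩ P? Q? ⟩
  count P? + count Q?                  ∎
  where open ≡-Reasoning

_∖?_ : {P : Pred (Fin m) p} → Decidable P → (a : Fin m) → Decidable (P ∖ ｛ a ｝)
P? ∖? a = P? ∩? ∁? (a ≟_)

count-remove : {P : Pred (Fin m) p} (P? : Decidable P) {a : Fin m} → P a →
               count P? ≡ suc (count (P? ∖? a))
count-remove P? {a} Pa = begin
  count P?                           ≡⟨ count-cong P? ((P? ∖? a) ∪? (a ≟_)) (split , join) ⟩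
  count ((P? ∖? a) ∪? (a ≟_))        ≡⟨ count-disjoint-∪ (P? ∖? a) (a ≟_) (λ _ ((_ , a≢x) , a≡x) → a≢x a≡x) ⟩
  count (P? ∖? a) + count (a ≟_)     ≡⟨ cong (count (P? ∖? a) +_) (count-singleton a) ⟩
  count (P? ∖? a) + 1                ≡⟨ +-comm _ 1 ⟩
  suc (count (P? ∖? a))              ∎
  where
  open ≡-Reasoning
  split : _ ⊆ (_ ∖ ｛ a ｝) ∪ ｛ a ｝
  split {x} Px with a ≟ x
  ... | yes a≡x = inj₂ a≡x
  ... | no  a≢x = inj₁ (Px , a≢x)
  join : (_ ∖ ｛ a ｝) ∪ ｛ a ｝ ⊆ _
  join (inj₁ (Px , _)) = Px
  join (inj₂ refl)     = Pa

count≤suc : {P : Pred (Fin m) p} (P? : Decidable P) {n : ℕ} →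
            (∀ {a} → P a → count (P? ∖? a) ≤ n) → count P? ≤ suc n
count≤suc P? bound with any? P?
... | yes (a , Pa) = ≤-trans (≤-reflexive (count-remove P? Pa)) (s≤s (bound Pa))
... | no ¬sat      = ≤-trans (≤-reflexive (count-empty P? λ x Px → ¬sat (x , Px))) z≤n

NoThreeDistinct : Pred (Fin m) p → Set p
NoThreeDistinct P = ∀ {a b c} → P a → P b → P c → a ≢ b → a ≢ c → b ≢ c → ⊥

count≤2 : {P : Pred (Fin m) p} (P? : Decidable P) → NoThreeDistinct P → count P? ≤ 2
count≤2 P? noThree = count≤suc P? λ {a} Pa → count≤suc (P? ∖? a) λ {b} (Pb , a≢b) →
  ≤-reflexive (count-empty ((P? ∖? a) ∖? b) λ _ ((Pc , a≢c) , b≢c) → noThree Pa Pb Pc a≢b a≢c b≢c)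

count≥3 : {P : Pred (Fin m) p} (P? : Decidable P) {a b c : Fin m} →
          P a → P b → P c → a ≢ b → a ≢ c → b ≢ c → 3 ≤ count P?
count≥3 P? {a} {b} {c} Pa Pb Pc a≢b a≢c b≢c = subst (3 ≤_) (sym count≡) (s≤s (s≤s (s≤s z≤n)))
  where
  count≡ : count P? ≡ 3 + count (((P? ∖? a) ∖? b) ∖? c)
  count≡ = trans (count-remove P? Pa) (cong suc (trans (count-remove (P? ∖? a) (Pb , a≢b))
             (cong suc (count-remove ((P? ∖? a) ∖? b) ((Pc , a≢c) , b≢c)))))

count≥2⇒another : {P : Pred (Fin m) p} (P? : Decidable P) {a : Fin m} → P a → 2 ≤ count P? →
                  Satisfiable (P ∖ ｛ a ｝)
count≥2⇒another P? Pa 2≤count =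
  count>0⇒satisfiable (P? ∖? _) (≤-pred (subst (2 ≤_) (count-remove P? Pa) 2≤count))

open IsKPartiteTournament

TriangleFree : {n : ℕ} → Graph n → Set
TriangleFree G = ∀ {a b c} → G a b → G b c → G a c → ⊥

NicheLeaf : Digraph m → Fin m → Fin m → Set
NicheLeaf D x y = ∀ {v} → Niche D x v → v ≡ y

outDegree inDegree : {D : Digraph m} → Decidable₂ D → Fin m → ℕ
outDegree D? v = count (D? v)
inDegree  D? v = count (flip D? v)

partSize outsideSize : (part : Fin m → Fin k) → Fin k → ℕ
partSize    part c = count (λ w → part w ≟ c)
outsideSize part c = count (∁? (λ w → part w ≟ c))

Niche-flip : {u v : Fin m} → Niche D u v → Niche (flip D) u v
Niche-flip (u≢v , inj₁ common) = u≢v , inj₂ common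
Niche-flip (u≢v , inj₂ common) = u≢v , inj₁ common

TriangleFree-flip : TriangleFree (Niche D) → TriangleFree (Niche (flip D))
TriangleFree-flip tf ab bc ac = tf (Niche-flip ab) (Niche-flip bc) (Niche-flip ac)

NicheLeaf-flip : {x y : Fin m} → NicheLeaf D x y → NicheLeaf (flip D) x y
NicheLeaf-flip leaf = leaf ∘ Niche-flip

reverse : IsKPartiteTournament k D part → IsKPartiteTournament k (flip D) part
reverse KT = record
  { nonempty    = nonempty KT
  ; noArcInside = λ u v same → noArcInside KT v u (sym same)
  ; someArc     = λ u v diff → swap (someArc KT u v diff)
  ; notBoth     = λ u v → notBoth KT v u
  }

arc? : IsKPartiteTournament k D part → Decidable₂ D
arc? {part = part} KT u v with part u ≟ part v
... | yes same = no (noArcInside KT u v same)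
... | no diff with someArc KT u v diff
...   | inj₁ uv = yes uv
...   | inj₂ vu = no λ uv → notBoth KT u v (uv , vu)

outDegree≤2 : TriangleFree (Niche D) → (D? : Decidable₂ D) (v : Fin m) → outDegree D? v ≤ 2
outDegree≤2 tf D? v = count≤2 (D? v) λ va vb vc a≢b a≢c b≢c →
  tf (a≢b , inj₂ (v , va , vb)) (b≢c , inj₂ (v , vb , vc)) (a≢c , inj₂ (v , va , vc))

inDegree≤2 : TriangleFree (Niche D) → (D? : Decidable₂ D) (v : Fin m) → inDegree D? v ≤ 2
inDegree≤2 tf D? = outDegree≤2 (TriangleFree-flip tf) (flip D?)

outsideSize≤degree : IsKPartiteTournament k D part → (D? : Decidable₂ D) (v : Fin m) →
                     outsideSize part (part v) ≤ outDegree D? v + inDegree D? v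
outsideSize≤degree {part = part} KT D? v = ≤-trans
  (count-mono (∁? (λ w → part w ≟ part v)) (D? v ∪? flip D? v) λ diff → someArc KT v _ (diff ∘ sym))
  (count-∪≤ (D? v) (flip D? v))

outsideSize≤4 : IsKPartiteTournament k D part → TriangleFree (Niche D) →
                (c : Fin k) → outsideSize part c ≤ 4
outsideSize≤4 KT tf c with nonempty KT c
... | v , refl = ≤-trans (outsideSize≤degree KT (arc? KT) v)
                         (+-mono-≤ (outDegree≤2 tf (arc? KT) v) (inDegree≤2 tf (arc? KT) v))

arc⇒partsDiffer : IsKPartiteTournament k D part → {u v : Fin m} → D u v → part u ≢ part v
arc⇒partsDiffer KT uv same = noArcInside KT _ _ same uv

arc⇒≢ : IsKPartiteTournament k D part → {u v : Fin m} → D u v → u ≢ v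
arc⇒≢ KT uv refl = arc⇒partsDiffer KT uv refl

module Leaf {D : Digraph m} {part : Fin m → Fin k} (KT : IsKPartiteTournament k D part)
            {x y : Fin m} (leaf : NicheLeaf D x y) where

  shareOut⇒≡y : {a w : Fin m} → D x a → D w a → w ≢ x → w ≡ y
  shareOut⇒≡y xa wa w≢x = leaf ((w≢x ∘ sym) , inj₁ (_ , xa , wa))

  partner-inNeighbour : {w : Fin m} → D x y → D w y → w ≡ x
  partner-inNeighbour {w} xy wy with w ≟ x
  ... | yes w≡x = w≡x
  ... | no  w≢x = contradiction (shareOut⇒≡y xy wy w≢x) λ w≡y → arc⇒≢ KT wy w≡y

  partner-inDegree≤1 : D x y → (D? : Decidable₂ D) → inDegree D? y ≤ 1
  partner-inDegree≤1 xy D? = ≤-trans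
    (count-mono (flip D? y) (x ≟_) (sym ∘ partner-inNeighbour xy))
    (≤-reflexive (count-singleton x))

  outNeighbours-samePart : {a b : Fin m} → D x a → D x b → a ≢ y → b ≢ y → part a ≡ part b
  outNeighbours-samePart {a} {b} xa xb a≢y b≢y with part a ≟ part b
  ... | yes same = same
  ... | no diff with someArc KT a b diff
  ...   | inj₁ ab = contradiction (shareOut⇒≡y xb ab (arc⇒≢ KT xa ∘ sym)) a≢y
  ...   | inj₂ ba = contradiction (shareOut⇒≡y xa ba (arc⇒≢ KT xb ∘ sym)) b≢y

threeOthers : 4 ≤ k → (c : Fin k) →
              ∃ λ (f : Fin 3 → Fin k) → Injective _≡_ _≡_ f × (∀ i → c ≢ f i)
threeOthers (s≤s 3≤k) c =
  (λ i → punchIn c (inject≤ i 3≤k)) ,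
  (λ {i} {j} eq → inject≤-injective 3≤k 3≤k i j (punchIn-injective c _ _ eq)) ,
  (λ i → punchInᵢ≢i c (inject≤ i 3≤k) ∘ sym)

module _ {D : Digraph m} {part : Fin m → Fin k} (KT : IsKPartiteTournament k D part)
         {x y : Fin m} (leaf : NicheLeaf D x y) where

  private
    module L  = Leaf KT leaf
    module Lʳ = Leaf (reverse KT) (NicheLeaf-flip leaf)
    D? = arc? KT

  threeNewParts⇒⊥ : (w : Fin 3 → Fin m) → (∀ i → w i ≢ y) → (∀ i → part x ≢ part (w i)) →
                    Injective _≡_ _≡_ (part ∘ w) → ⊥
  threeNewParts⇒⊥ w w≢y new inj = twoAlike (arc 0F) (arc 1F) (arc 2F)
    where
    arc : (i : Fin 3) → D x (w i) ⊎ D (w i) x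
    arc i = someArc KT x (w i) (new i)

    bothOut : {i j : Fin 3} → D x (w i) → D x (w j) → i ≡ j
    bothOut x→a x→b = inj (L.outNeighbours-samePart x→a x→b (w≢y _) (w≢y _))

    bothIn : {i j : Fin 3} → D (w i) x → D (w j) x → i ≡ j
    bothIn a→x b→x = inj (Lʳ.outNeighbours-samePart a→x b→x (w≢y _) (w≢y _))

    twoAlike : D x (w 0F) ⊎ D (w 0F) x → D x (w 1F) ⊎ D (w 1F) x → D x (w 2F) ⊎ D (w 2F) x → ⊥
    twoAlike (inj₁ x→a) (inj₁ x→b) _          = contradiction (bothOut x→a x→b) λ ()
    twoAlike (inj₁ x→a) _          (inj₁ x→c) = contradiction (bothOut x→a x→c) λ ()
    twoAlike _          (inj₁ x→b) (inj₁ x→c) = contradiction (bothOut x→b x→c) λ ()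
    twoAlike (inj₂ a→x) (inj₂ b→x) _          = contradiction (bothIn a→x b→x) λ ()
    twoAlike (inj₂ a→x) _          (inj₂ c→x) = contradiction (bothIn a→x c→x) λ ()
    twoAlike _          (inj₂ b→x) (inj₂ c→x) = contradiction (bothIn b→x c→x) λ ()

  partner-alone : 4 ≤ k → {v : Fin m} → part v ≡ part y → v ≡ y
  -- Otherwise every part has a vertex other than y, and three parts differ from that of x.
  partner-alone 4≤k {v} same with v ≟ y
  ... | yes v≡y = v≡y
  ... | no  v≢y with threeOthers 4≤k (part x)
  ...   | f , f-inj , f-new = ⊥-elim (threeNewParts⇒⊥ (vertex ∘ f) (vertex≢y ∘ f)
            (λ i → subst (part x ≢_) (sym (vertex-part (f i))) (f-new i))
            λ {i} {j} eq → f-inj (trans (sym (vertex-part (f i))) (trans eq (vertex-part (f j)))))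
    where
    witness : (c : Fin k) → ∃ λ w → part w ≡ c × w ≢ y
    witness c with c ≟ part y
    ... | yes refl = v , same , v≢y
    ... | no  c≢py with nonempty KT c
    ...   | w , refl = w , refl , c≢py ∘ cong part

    vertex : Fin k → Fin m
    vertex = proj₁ ∘ witness

    vertex-part : (c : Fin k) → part (vertex c) ≡ c
    vertex-part = proj₁ ∘ proj₂ ∘ witness

    vertex≢y : (c : Fin k) → vertex c ≢ y
    vertex≢y = proj₂ ∘ proj₂ ∘ witness

  partner-outNeighbour : 4 ≤ k → D x y → {v : Fin m} → v ≢ x → v ≢ y → D y v
  partner-outNeighbour 4≤k xy {v} v≢x v≢y with someArc KT y v (v≢y ∘ partner-alone 4≤k ∘ sym)
  ... | inj₁ yv = yv
  ... | inj₂ vy = contradiction (L.partner-inNeighbour xy vy) v≢x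

  partner-outsideSize≤3 : TriangleFree (Niche D) → part x ≢ part y → outsideSize part (part y) ≤ 3
  partner-outsideSize≤3 tf diff with someArc KT x y diff
  ... | inj₁ xy = ≤-trans (outsideSize≤degree KT D? y)
                          (+-mono-≤ (outDegree≤2 tf D? y) (L.partner-inDegree≤1 xy D?))
  ... | inj₂ yx = ≤-trans (outsideSize≤degree KT D? y)
                          (+-mono-≤ (Lʳ.partner-inDegree≤1 yx (flip D?)) (inDegree≤2 tf D? y))

  leafPart-twoOut⇒⊥ : TriangleFree (Niche D) → part x ≡ part y →
                      (∀ {v} → part v ≡ part x → v ≡ x ⊎ v ≡ y) →
                      {z o : Fin m} → Niche D y z → D x z → D x o → o ≢ z → ⊥
  -- A common in-neighbour of y and z shares the out-neighbour z with x, so it is y: absurd. A common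
  -- out-neighbour w is an out-neighbour of o (niche triangle y z o) or an in-neighbour (forcing o = y).
  leafPart-twoOut⇒⊥ tf same partOf-x {z} {o} (y≢z , common) xz xo o≢z = commonNeighbour⇒⊥ common
    where
    o≢y : o ≢ y
    o≢y refl = arc⇒partsDiffer KT xo same

    samePart-oz : part o ≡ part z
    samePart-oz = L.outNeighbours-samePart xo xz o≢y (y≢z ∘ sym)

    newPart : {w : Fin m} → D y w → D z w → part x ≢ part w
    newPart yw zw same′ with partOf-x (sym same′)
    ... | inj₁ refl = notBoth KT x z (xz , zw)
    ... | inj₂ refl = arc⇒≢ KT yw refl

    commonNeighbour⇒⊥ : (∃ λ w → D y w × D z w) ⊎ (∃ λ w → D w y × D w z) → ⊥
    commonNeighbour⇒⊥ (inj₂ (w , wy , wz)) with w ≟ x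
    ... | yes refl = arc⇒partsDiffer KT wy same
    ... | no  w≢x  = arc⇒≢ KT wy (L.shareOut⇒≡y xz wz w≢x)
    commonNeighbour⇒⊥ (inj₁ (w , yw , zw)) with someArc KT x w (newPart yw zw)
    ... | inj₁ xw = arc⇒partsDiffer KT zw
                      (L.outNeighbours-samePart xz xw (y≢z ∘ sym) (arc⇒≢ KT yw ∘ sym))
    ... | inj₂ wx with someArc KT o w (arc⇒partsDiffer KT zw ∘ trans (sym samePart-oz))
    ...   | inj₁ ow = tf (y≢z , inj₁ (w , yw , zw)) ((o≢z ∘ sym) , inj₁ (w , zw , ow))
                         ((o≢y ∘ sym) , inj₁ (w , yw , ow))
    ...   | inj₂ wo = o≢y (Lʳ.shareOut⇒≡y wx wo (arc⇒≢ KT xo ∘ sym))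

k≥4⇒nicheAdjacent : IsKPartiteTournament k D part → {x y : Fin m} → NicheLeaf D x y → 4 ≤ k → x ≢ y →
                    {a c : Fin m} → a ≢ x → a ≢ y → c ≢ x → c ≢ y → a ≢ c → Niche D a c
k≥4⇒nicheAdjacent KT {x} {y} leaf 4≤k x≢y a≢x a≢y c≢x c≢y a≢c
  with someArc KT x y (x≢y ∘ partner-alone KT leaf 4≤k)
... | inj₁ xy = a≢c , inj₂ (_ , out a≢x a≢y , out c≢x c≢y)
  where out = partner-outNeighbour KT leaf 4≤k xy
... | inj₂ yx = a≢c , inj₁ (_ , into a≢x a≢y , into c≢x c≢y)
  where into = partner-outNeighbour (reverse KT) (NicheLeaf-flip leaf) 4≤k yx

partSize+partSize≤outsideSize : (part : Fin m → Fin k) {c₁ c₂ c : Fin k} →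
                                c₁ ≢ c₂ → c₁ ≢ c → c₂ ≢ c →
                                partSize part c₁ + partSize part c₂ ≤ outsideSize part c
partSize+partSize≤outsideSize part {c₁} {c₂} {c} c₁≢c₂ c₁≢c c₂≢c = begin
  partSize part c₁ + partSize part c₂  ≡⟨ count-disjoint-∪ (λ w → part w ≟ c₁) (λ w → part w ≟ c₂)
                                            (λ _ (eq₁ , eq₂) → c₁≢c₂ (trans (sym eq₁) eq₂)) ⟨
  count (in₁ ∪? in₂)                   ≤⟨ count-mono (in₁ ∪? in₂) (∁? (λ w → part w ≟ c)) outside ⟩
  outsideSize part c                   ∎
  where
  open ≤-Reasoning
  in₁ = λ w → part w ≟ c₁
  in₂ = λ w → part w ≟ c₂
  outside : (λ w → part w ≡ c₁ ⊎ part w ≡ c₂) ⊆ ∁ (λ w → part w ≡ c)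
  outside (inj₁ eq₁) eq = c₁≢c (trans (sym eq₁) eq)
  outside (inj₂ eq₂) eq = c₂≢c (trans (sym eq₂) eq)

module _ {D : Digraph m} {part : Fin m → Fin 3} (KT : IsKPartiteTournament 3 D part)
         (tf : TriangleFree (Niche D)) (6≤m : 6 ≤ m) where

  partSize≥2 : (c : Fin 3) → 2 ≤ partSize part c
  partSize≥2 c = +-cancelʳ-≤ 4 2 (partSize part c) (begin
    6                                           ≤⟨ 6≤m ⟩
    m                                           ≡⟨ count-complement (λ w → part w ≟ c) ⟨
    partSize part c + outsideSize part c        ≤⟨ +-monoʳ-≤ (partSize part c) (outsideSize≤4 KT tf c) ⟩
    partSize part c + 4                         ∎)
    where open ≤-Reasoning

  partSize≤2 : (c : Fin 3) → partSize part c ≤ 2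
  partSize≤2 c = +-cancelʳ-≤ 2 (partSize part c) 2 (begin
    partSize part c + 2                         ≤⟨ +-monoʳ-≤ (partSize part c) (partSize≥2 c₂) ⟩
    partSize part c + partSize part c₂          ≤⟨ partSize+partSize≤outsideSize part
                                                     (punchInᵢ≢i c 1F ∘ sym) (punchInᵢ≢i c 0F ∘ sym)
                                                     ((λ ()) ∘ punchIn-injective c 1F 0F) ⟩
    outsideSize part c₁                         ≤⟨ outsideSize≤4 KT tf c₁ ⟩
    4                                           ∎)
    where
    open ≤-Reasoning
    c₁ = punchIn c 0F
    c₂ = punchIn c 1F

  outsideSize≥4 : (c : Fin 3) → 4 ≤ outsideSize part c
  outsideSize≥4 c = begin
    4                                           ≤⟨ +-mono-≤ (partSize≥2 (punchIn c 0F)) (partSize≥2 (punchIn c 1F)) ⟩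
    partSize part (punchIn c 0F) + partSize part (punchIn c 1F)
                                                ≤⟨ partSize+partSize≤outsideSize part
                                                     ((λ ()) ∘ punchIn-injective c 0F 1F)
                                                     (punchInᵢ≢i c 0F) (punchInᵢ≢i c 1F) ⟩
    outsideSize part c                          ∎
    where open ≤-Reasoning

  outDegree≥2 : (D? : Decidable₂ D) (v : Fin m) → 2 ≤ outDegree D? v
  outDegree≥2 D? v = +-cancelʳ-≤ 2 2 (outDegree D? v) (begin
    4                                           ≤⟨ outsideSize≥4 (part v) ⟩
    outsideSize part (part v)                   ≤⟨ outsideSize≤degree KT D? v ⟩
    outDegree D? v + inDegree D? v              ≤⟨ +-monoʳ-≤ (outDegree D? v) (inDegree≤2 tf D? v) ⟩
    outDegree D? v + 2                          ∎)
    where open ≤-Reasoning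

  inDegree≥2 : (D? : Decidable₂ D) (v : Fin m) → 2 ≤ inDegree D? v
  inDegree≥2 D? v = +-cancelˡ-≤ 2 2 (inDegree D? v) (begin
    4                                           ≤⟨ outsideSize≥4 (part v) ⟩
    outsideSize part (part v)                   ≤⟨ outsideSize≤degree KT D? v ⟩
    outDegree D? v + inDegree D? v              ≤⟨ +-monoˡ-≤ (inDegree D? v) (outDegree≤2 tf D? v) ⟩
    2 + inDegree D? v                           ∎)
    where open ≤-Reasoning

  module _ {x y : Fin m} (leaf : NicheLeaf D x y) (x≢y : x ≢ y) where

    partner-samePart : part x ≡ part y
    partner-samePart with part x ≟ part y
    ... | yes same = same
    ... | no  diff = contradiction
      (≤-trans (outsideSize≥4 (part y)) (partner-outsideSize≤3 KT leaf tf diff)) 1+n≰n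

    partOf-x : {v : Fin m} → part v ≡ part x → v ≡ x ⊎ v ≡ y
    partOf-x {v} same with v ≟ x | v ≟ y
    ... | yes v≡x | _       = inj₁ v≡x
    ... | no _    | yes v≡y = inj₂ v≡y
    ... | no v≢x  | no v≢y  = contradiction
      (≤-trans (count≥3 (λ w → part w ≟ part x) refl (sym partner-samePart) same
                         x≢y (v≢x ∘ sym) (v≢y ∘ sym))
               (partSize≤2 (part x)))
      1+n≰n

    partnerNeighbour-newPart : {z : Fin m} → Niche D y z → z ≢ x → part x ≢ part z
    partnerNeighbour-newPart (y≢z , _) z≢x same with partOf-x (sym same)
    ... | inj₁ z≡x = z≢x z≡x
    ... | inj₂ z≡y = y≢z (sym z≡y)

    partnerNeighbour⇒⊥ : {z : Fin m} → Niche D y z → z ≢ x → ⊥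
    partnerNeighbour⇒⊥ {z} yz z≢x with someArc KT x z (partnerNeighbour-newPart yz z≢x)
    ... | inj₁ xz with count≥2⇒another (arc? KT x) xz (outDegree≥2 (arc? KT) x)
    ...   | o , xo , z≢o = leafPart-twoOut⇒⊥ KT leaf tf partner-samePart partOf-x yz xz xo (z≢o ∘ sym)
    partnerNeighbour⇒⊥ {z} yz z≢x | inj₂ zx
      with count≥2⇒another (flip (arc? KT) x) zx (inDegree≥2 (arc? KT) x)
    ...   | o , ox , z≢o = leafPart-twoOut⇒⊥ (reverse KT) (NicheLeaf-flip leaf) (TriangleFree-flip tf)
                             partner-samePart partOf-x (Niche-flip yz) zx ox (z≢o ∘ sym)

Path-triangleFree : {n : ℕ} → TriangleFree (Path n)
Path-triangleFree {a = a} {b} {c} = triangle (toℕ a) (toℕ b) (toℕ c)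
  where
  triangle : (i j l : ℕ) →
             (j ≡ suc i ⊎ i ≡ suc j) → (l ≡ suc j ⊎ j ≡ suc l) → (l ≡ suc i ⊎ i ≡ suc l) → ⊥
  triangle i _ _ (inj₁ refl) (inj₁ refl) (inj₁ eq) = 1+n≢n (ℕ.suc-injective eq)
  triangle i _ _ (inj₁ refl) (inj₁ refl) (inj₂ eq) = m≢1+n+m i eq
  triangle _ _ _ (inj₁ refl) (inj₂ refl) (inj₁ eq) = 1+n≢n (sym eq)
  triangle _ _ _ (inj₁ refl) (inj₂ refl) (inj₂ eq) = 1+n≢n (sym eq)
  triangle _ _ _ (inj₂ refl) (inj₁ refl) (inj₁ eq) = 1+n≢n (sym eq)
  triangle _ _ _ (inj₂ refl) (inj₁ refl) (inj₂ eq) = 1+n≢n (sym eq)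
  triangle _ _ l (inj₂ refl) (inj₂ refl) (inj₁ eq) = m≢1+n+m l eq
  triangle _ _ _ (inj₂ refl) (inj₂ refl) (inj₂ eq) = 1+n≢n (ℕ.suc-injective eq)

Path-endpoint : {n : ℕ} {j : Fin (2 + n)} → Path (2 + n) zero j → j ≡ suc zero
Path-endpoint {j = zero}          (inj₁ ())
Path-endpoint {j = suc zero}      _         = refl
Path-endpoint {j = suc (suc _)}   (inj₁ ())
Path-endpoint                     (inj₂ ())

module Isomorphism {n m : ℕ} {G : Graph n} {H : Graph m} (G≅H : G ≅ H) where

  private
    f = proj₁ G≅H
    iso = proj₂ G≅H
    open Bijection f using (to; injective; strictlySurjective)

  distinct : {i j : Fin n} → i ≢ j → to i ≢ to j
  distinct i≢j = i≢j ∘ injective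

  adjacent : {i j : Fin n} → G i j → H (to i) (to j)
  adjacent = Equivalence.to (iso _ _)

  nonadjacent : {i j : Fin n} → ¬ G i j → ¬ H (to i) (to j)
  nonadjacent ¬ij = ¬ij ∘ Equivalence.from (iso _ _)

  triangleFree : TriangleFree G → TriangleFree H
  triangleFree tf {a} {b} {c} ab bc ac
    with strictlySurjective a | strictlySurjective b | strictlySurjective c
  ... | i , refl | j , refl | l , refl =
    tf (Equivalence.from (iso i j) ab) (Equivalence.from (iso j l) bc) (Equivalence.from (iso i l) ac)

  uniqueNeighbour : {i i′ : Fin n} → (∀ {j} → G i j → j ≡ i′) → ∀ {w} → H (to i) w → w ≡ to i′
  uniqueNeighbour unique {w} iw with strictlySurjective w
  ... | j , refl = cong to (unique (Equivalence.from (iso _ j) iw))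

  size≤ : n ≤ m
  size≤ = injective⇒≤ injective

¬realizable-k≥4 : {n k : ℕ} → 4 ≤ k → ¬ NicheRealizable (Path (5 + n)) k
¬realizable-k≥4 4≤k (_ , D , (_ , KT) , P≅N) =
  nonadjacent {2F} {4F} (λ { (inj₁ ()) ; (inj₂ ()) })
    (k≥4⇒nicheAdjacent KT (uniqueNeighbour Path-endpoint) 4≤k
       (distinct λ ()) (distinct λ ()) (distinct λ ()) (distinct λ ()) (distinct λ ()) (distinct λ ()))
  where open Isomorphism {H = Niche D} P≅N

¬realizable-3 : {n : ℕ} → ¬ NicheRealizable (Path (6 + n)) 3
¬realizable-3 {n} (_ , D , (_ , KT) , P≅N) =
  partnerNeighbour⇒⊥ KT (triangleFree Path-triangleFree) (≤-trans (m≤m+n 6 n) size≤)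
    (uniqueNeighbour Path-endpoint) (distinct λ ()) (adjacent {1F} {2F} (inj₁ refl)) (distinct λ ())
  where open Isomorphism {H = Niche D} P≅N

_⇔?_ : {A B : Set} → Dec A → Dec B → Dec (A ⇔ B)
A? ⇔? B? = map′ (λ (to , from) → mk⇔ to from) (λ A⇔B → Equivalence.to A⇔B , Equivalence.from A⇔B)
                ((A? →-dec B?) ×-dec (B? →-dec A?))

niche? : {D : Digraph m} → Decidable₂ D → Decidable₂ (Niche D)
niche? D? u v =
  ¬? (u ≟ v) ×-dec (any? (λ w → D? u w ×-dec D? v w) ⊎-dec any? (λ w → D? w u ×-dec D? w v))

path? : {n : ℕ} → Decidable₂ (Path n)
path? i j = (toℕ j ℕ.≟ suc (toℕ i)) ⊎-dec (toℕ i ℕ.≟ suc (toℕ j))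

isKPartiteTournament? : {D : Digraph m} → Decidable₂ D → (part : Fin m → Fin k) →
                        Dec (IsKPartiteTournament k D part)
isKPartiteTournament? D? part = map′
  (λ (nonempty , noArcInside , someArc , notBoth) → record
    { nonempty = nonempty ; noArcInside = noArcInside ; someArc = someArc ; notBoth = notBoth })
  (λ KT → nonempty KT , noArcInside KT , someArc KT , notBoth KT)
  (all? (λ c → any? λ v → part v ≟ c) ×-dec
   all? (λ u → all? λ v → (part u ≟ part v) →-dec ¬? (D? u v)) ×-dec
   all? (λ u → all? λ v → ¬? (part u ≟ part v) →-dec (D? u v ⊎-dec D? v u)) ×-dec
   all? (λ u → all? λ v → ¬? (D? u v ×-dec D? v u)))

realizable-byDecision : {n k : ℕ} {D : Digraph n} (D? : Decidable₂ D) (part : Fin n → Fin k) →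
                        True (isKPartiteTournament? D? part) →
                        True (all? λ i → all? λ j → path? i j ⇔? niche? D? i j) →
                        NicheRealizable (Path n) k
realizable-byDecision {n} D? part isKPT isPath =
  n , _ , (part , toWitness isKPT) , ⤖-id (Fin n) , toWitness isPath

ArcList : List (ℕ × ℕ) → Digraph m
ArcList arcs u v = (toℕ u , toℕ v) ∈ arcs

arcList? : (arcs : List (ℕ × ℕ)) → Decidable₂ (ArcList {m} arcs)
arcList? arcs u v = (toℕ u , toℕ v) ∈? arcs

realizable-P₃-3 : NicheRealizable (Path 3) 3
realizable-P₃-3 = realizable-byDecision (arcList? ((1 , 0) ∷ (2 , 0) ∷ (2 , 1) ∷ [])) id _ _

realizable-P₄-3 : NicheRealizable (Path 4) 3
realizable-P₄-3 = realizable-byDecision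
  (arcList? ((2 , 0) ∷ (0 , 3) ∷ (2 , 1) ∷ (3 , 1) ∷ (3 , 2) ∷ []))
  (lookup (0F ∷ 0F ∷ 1F ∷ 2F ∷ [])) _ _

realizable-P₄-4 : NicheRealizable (Path 4) 4
realizable-P₄-4 = realizable-byDecision
  (arcList? ((1 , 0) ∷ (2 , 0) ∷ (0 , 3) ∷ (2 , 1) ∷ (3 , 1) ∷ (3 , 2) ∷ [])) id _ _

realizable-P₅-3 : NicheRealizable (Path 5) 3
realizable-P₅-3 = realizable-byDecision
  (arcList? ((2 , 0) ∷ (0 , 3) ∷ (0 , 4) ∷ (2 , 1) ∷ (3 , 1) ∷ (1 , 4) ∷ (3 , 2) ∷ (4 , 2) ∷ []))
  (lookup (0F ∷ 0F ∷ 1F ∷ 2F ∷ 2F ∷ [])) _ _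

Exceptional : ℕ → ℕ → Set
Exceptional n k = (n ≡ 3 × k ≡ 3) ⊎ (n ≡ 4 × k ≡ 3) ⊎ (n ≡ 4 × k ≡ 4) ⊎ (n ≡ 5 × k ≡ 3)

exceptional⇒realizable : {n k : ℕ} → Exceptional n k → NicheRealizable (Path n) k
exceptional⇒realizable (inj₁ (refl , refl))               = realizable-P₃-3
exceptional⇒realizable (inj₂ (inj₁ (refl , refl)))        = realizable-P₄-3
exceptional⇒realizable (inj₂ (inj₂ (inj₁ (refl , refl)))) = realizable-P₄-4
exceptional⇒realizable (inj₂ (inj₂ (inj₂ (refl , refl)))) = realizable-P₅-3

realizable⇒exceptional : {n k : ℕ} → 3 ≤ k → k ≤ n → NicheRealizable (Path n) k → Exceptional n k
realizable⇒exceptional 3≤k k≤n with m≤n⇒∃[o]m+o≡n 3≤k | m≤n⇒∃[o]m+o≡n k≤n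
... | e , refl | d , refl = byExcess e d
  where
  byExcess : (e d : ℕ) → NicheRealizable (Path (3 + e + d)) (3 + e) → Exceptional (3 + e + d) (3 + e)
  byExcess 0 0 _                     = inj₁ (refl , refl)
  byExcess 0 1 _                     = inj₂ (inj₁ (refl , refl))
  byExcess 0 2 _                     = inj₂ (inj₂ (inj₂ (refl , refl)))
  byExcess 0 (suc (suc (suc _))) R   = ⊥-elim (¬realizable-3 R)
  byExcess 1 0 _                     = inj₂ (inj₂ (inj₁ (refl , refl)))
  byExcess 1 (suc _) R               = ⊥-elim (¬realizable-k≥4 ≤-refl R)
  byExcess (suc (suc _)) _ R         = ⊥-elim (¬realizable-k≥4 (s≤s (s≤s (s≤s (s≤s z≤n)))) R)

lemma4p7 : (n k : ℕ) → 3 ≤ k → k ≤ n →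
    (NicheRealizable (Path n) k ⇔
      ((n ≡ 3 × k ≡ 3) ⊎ (n ≡ 4 × k ≡ 3) ⊎ (n ≡ 4 × k ≡ 4) ⊎ (n ≡ 5 × k ≡ 3)))
lemma4p7 n k 3≤k k≤n = mk⇔ (realizable⇒exceptional 3≤k k≤n) exceptional⇒realizable
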